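{- Let $k>1$ be an integer and let $r=[a_0;a_1,a_2]$ be a $(\sigma,k)$-permutiple for some permutation $\sigma$ of $\{0,1,2\}$. Then $r$ is continuant-preserving and $r$ is a $k$-reverse multiple, i.e. $[a_0;a_1,a_2]=k\,[a_2;a_1,a_0]$.
   Context: For positive integers $a_0,\ldots,a_n$, $[a_0;a_1,\ldots,a_n]$ denotes the finite simple continued fraction $a_0+1/(a_1+1/(\cdots+1/a_n))$; all finite continued fractions are assumed in canonical form (last digit at least $2$ when there are at least two digits). For an integer $k>1$ and a permutation $\sigma$ of $\{0,\ldots,n\}$, $r=[a_0;\ldots,a_n]$ is a $(\sigma,k)$-permutiple if $r=k\,[a_{\sigma(0)};a_{\sigma(1)},\ldots,a_{\sigma(n)}]$. Continuants: $K_0()=1$, $K_1(x_0)=x_0$, $K_m(x_0,\ldots,x_{m-1})=x_{m-1}K_{m-1}(x_0,\ldots,x_{m-2})+K_{m-2}(x_0,\ldots,x_{m-3})$. The permutiple is continuant-preserving if $K_{n+1}(a_0,\ldots,a_n)=K_{n+1}(a_{\sigma(0)},\ldots,a_{\sigma(n)})$. A $k$-reverse multiple is a $(\sigma,k)$-permutiple with $\sigma(j)=n-j$ for all $j$. -}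

module Defs where

open import Data.Nat as ℕ using (ℕ; zero; suc; _+_; _*_)
open import Data.List using (List; []; _∷_; foldl)
open import Data.Product using (_×_; _,_; proj₁)
open import Data.Rational as ℚ using (ℚ; 0ℚ; 1/_; ≢-nonZero)
open import Data.Rational.Properties using (_≟_)
open import Data.Integer using (+_)
open import Relation.Nullary using (yes; no)

-- Total reciprocal on ℚ: 1/q when q ≠ 0, and 0 otherwise.
-- (Only ever applied to strictly positive values below, when all digits are ≥ 1.)
recip : ℚ → ℚ
recip q with q ≟ 0ℚ
... | yes _ = 0ℚ
... | no q≢0 = 1/_ q {{≢-nonZero q≢0}}

ofℕ : ℕ → ℚ
ofℕ a = (+ a) ℚ./ 1

cf : ℕ → List ℕ → ℚ
cf a []       = ofℕ a
cf a (b ∷ bs) = ofℕ a ℚ.+ recip (cf b bs)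

-- Continuants: K over a list x₀ … x_{m-1}, computed left-to-right with the recurrence
-- K_m = x_{m-1} K_{m-1} + K_{m-2}, K_0 = 1 (and K_{-1} = 0 so that K_1 = x₀).
K : List ℕ → ℕ
K xs = proj₁ (foldl step (1 , 0) xs)
  where
  step : ℕ × ℕ → ℕ → ℕ × ℕ
  step (p , q) x = (x * p + q , p)

module Submission where

-- Write [a; b, c] = N(a,b,c) / D(b,c) with D(b,c) = 1 + b c and N(a,b,c) = c + a D(b,c);
-- these are the continuants, and N and D are coprime.  If [a; b, c] = k [x; y, z] with
-- (x, y, z) a rearrangement of (a, b, c), clearing denominators gives N D' = k N' D, so
-- N' divides N by coprimality.  Since N = abc + (a + c) with a + c ≤ abc + 1, while
-- N' = abc + (x + z) with x + z ≥ 1, we get N < 2 N', hence N = N' and a + c = x + z.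
-- Running through the six rearrangements, this forces (x, y, z) to be either (a, b, c)
-- itself, which is impossible for k > 1, or (c, b, a); and continuants are invariant under
-- reversal.

open import Defs
open import Data.Nat using (ℕ; _≤_; _<_)
open import Data.Fin using (Fin)
open import Data.Fin.Patterns using (0F; 1F; 2F)
open import Data.Fin.Permutation using (Permutation′; _⟨$⟩ʳ_; _⟨$⟩ˡ_; inverseˡ)
open import Data.List using (_∷_; [])
open import Data.Product using (_×_; _,_)
open import Data.Sum using (_⊎_; inj₁; inj₂)
open import Data.Empty using (⊥-elim)
open import Relation.Nullary using (¬_)
open import Relation.Binary.PropositionalEquality

import Data.Nat as ℕ

-- Denominator and numerator of [a; b, c] in lowest terms (the continuants of (b, c) and (a, b, c)).
denom : ℕ → ℕ → ℕ
denom b c = 1 ℕ.+ b ℕ.* c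

numer : ℕ → ℕ → ℕ → ℕ
numer a b c = c ℕ.+ a ℕ.* denom b c

K-reverse : ∀ a b c → K (a ∷ b ∷ c ∷ []) ≡ K (c ∷ b ∷ a ∷ [])
K-reverse a b c = symmetric a b c
  where
  open import Data.Nat using (_+_; _*_)
  open import Data.Nat.Tactic.RingSolver using (solve-∀)
  -- K (a ∷ b ∷ c ∷ []) unfolds to c (b (a 1 + 0) + 1) + (a 1 + 0).
  symmetric : ∀ a b c → c * (b * (a * 1 + 0) + 1) + (a * 1 + 0) ≡ a * (b * (c * 1 + 0) + 1) + (c * 1 + 0)
  symmetric = solve-∀

module Clearing where
  open import Data.Integer as ℤ using (+_)
  import Data.Integer.Properties as ℤ
  import Data.Nat.Coprimality as Coprime
  open import Data.Rational as ℚ using (ℚ; mkℚ; 0ℚ; 1ℚ)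
  open import Data.Rational.Properties as ℚ using (normalize-coprime; /-cong; _≟_)
  open import Data.Rational.Solver using (module +-*-Solver)
  open import Relation.Nullary using (yes; no)
  open ≡-Reasoning

  integral : ℕ → ℚ
  integral m = mkℚ (+ m) 0 (Coprime.sym (Coprime.1-coprimeTo m))

  ofℕ-integral : ∀ m → ofℕ m ≡ integral m
  ofℕ-integral m = normalize-coprime (Coprime.sym (Coprime.1-coprimeTo m))

  ofℕ-+ : ∀ m n → ofℕ (m ℕ.+ n) ≡ ofℕ m ℚ.+ ofℕ n
  ofℕ-+ m n = begin
    ofℕ (m ℕ.+ n)                                ≡⟨ /-cong pos-+ refl ⟩
    (+ m ℤ.* + 1 ℤ.+ + n ℤ.* + 1) ℚ./ (1 ℕ.* 1)  ≡⟨⟩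
    integral m ℚ.+ integral n                    ≡⟨ sym (cong₂ ℚ._+_ (ofℕ-integral m) (ofℕ-integral n)) ⟩
    ofℕ m ℚ.+ ofℕ n                              ∎
    where
    pos-+ : + (m ℕ.+ n) ≡ + m ℤ.* + 1 ℤ.+ + n ℤ.* + 1
    pos-+ = trans (ℤ.pos-+ m n) (sym (cong₂ ℤ._+_ (ℤ.*-identityʳ (+ m)) (ℤ.*-identityʳ (+ n))))

  ofℕ-* : ∀ m n → ofℕ (m ℕ.* n) ≡ ofℕ m ℚ.* ofℕ n
  ofℕ-* m n = begin
    ofℕ (m ℕ.* n)                ≡⟨ /-cong (ℤ.pos-* m n) refl ⟩
    (+ m ℤ.* + n) ℚ./ (1 ℕ.* 1)  ≡⟨⟩
    integral m ℚ.* integral n    ≡⟨ sym (cong₂ ℚ._*_ (ofℕ-integral m) (ofℕ-integral n)) ⟩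
    ofℕ m ℚ.* ofℕ n              ∎

  ofℕ-injective : ∀ {m n} → ofℕ m ≡ ofℕ n → m ≡ n
  ofℕ-injective {m} {n} e =
    ℤ.+-injective (cong ℚ.numerator (trans (sym (ofℕ-integral m)) (trans e (ofℕ-integral n))))

  ofℕ-nonZero : ∀ n → .{{ℕ.NonZero n}} → ¬ ofℕ n ≡ 0ℚ
  ofℕ-nonZero (ℕ.suc n) e with ofℕ-injective {ℕ.suc n} {0} (trans e (sym (ofℕ-integral 0)))
  ... | ()

  recip-inverseˡ : ∀ q → ¬ q ≡ 0ℚ → recip q ℚ.* q ≡ 1ℚ
  recip-inverseˡ q q≢0 with q ≟ 0ℚ
  ... | yes q≡0 = ⊥-elim (q≢0 q≡0)
  ... | no q≢0′ = ℚ.*-inverseˡ q {{ℚ.≢-nonZero q≢0′}}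

  cf-cons-cleared : ∀ a b bs {p q} → .{{ℕ.NonZero q}} →
                    cf b bs ℚ.* ofℕ p ≡ ofℕ q → cf a (b ∷ bs) ℚ.* ofℕ q ≡ ofℕ (p ℕ.+ a ℕ.* q)
  cf-cons-cleared a b bs {p} {q} tail = begin
    (A ℚ.+ recip x) ℚ.* Q              ≡⟨ ℚ.*-distribʳ-+ Q A (recip x) ⟩
    A ℚ.* Q ℚ.+ recip x ℚ.* Q          ≡⟨ cong (λ t → A ℚ.* Q ℚ.+ recip x ℚ.* t) (sym tail) ⟩
    A ℚ.* Q ℚ.+ recip x ℚ.* (x ℚ.* P)  ≡⟨ cong (A ℚ.* Q ℚ.+_) (sym (ℚ.*-assoc (recip x) x P)) ⟩
    A ℚ.* Q ℚ.+ recip x ℚ.* x ℚ.* P    ≡⟨ cong (λ t → A ℚ.* Q ℚ.+ t ℚ.* P) (recip-inverseˡ x x≢0) ⟩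
    A ℚ.* Q ℚ.+ 1ℚ ℚ.* P               ≡⟨ cong (A ℚ.* Q ℚ.+_) (ℚ.*-identityˡ P) ⟩
    A ℚ.* Q ℚ.+ P                      ≡⟨ ℚ.+-comm (A ℚ.* Q) P ⟩
    P ℚ.+ A ℚ.* Q                      ≡⟨ sym (trans (ofℕ-+ p (a ℕ.* q)) (cong (P ℚ.+_) (ofℕ-* a q))) ⟩
    ofℕ (p ℕ.+ a ℕ.* q)                ∎
    where
    A = ofℕ a
    P = ofℕ p
    Q = ofℕ q
    x = cf b bs
    -- x cannot vanish, since x P = Q ≠ 0.
    x≢0 : ¬ x ≡ 0ℚ
    x≢0 x≡0 = ofℕ-nonZero q (trans (sym tail) (trans (cong (ℚ._* P) x≡0) (ℚ.*-zeroˡ P)))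

  cf₃-cleared : ∀ a b c → .{{ℕ.NonZero c}} → cf a (b ∷ c ∷ []) ℚ.* ofℕ (denom b c) ≡ ofℕ (numer a b c)
  cf₃-cleared a b c = cf-cons-cleared a b (c ∷ []) {c} {denom b c} (cf-cons-cleared b c [] {1} {c} last)
    where
    last : ofℕ c ℚ.* ofℕ 1 ≡ ofℕ c
    last = trans (cong (ofℕ c ℚ.*_) (ofℕ-integral 1)) (ℚ.*-identityʳ (ofℕ c))

  cross-multiply : ∀ {r r′ W W′ n n′} κ → r ℚ.* W ≡ n → r′ ℚ.* W′ ≡ n′ → r ≡ κ ℚ.* r′ →
                   n ℚ.* W′ ≡ κ ℚ.* n′ ℚ.* W
  cross-multiply {r} {r′} {W} {W′} {n} {n′} κ rW≡n r′W′≡n′ r≡κr′ = begin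
    n ℚ.* W′                  ≡⟨ cong (λ t → t ℚ.* W′) (sym rW≡n) ⟩
    r ℚ.* W ℚ.* W′            ≡⟨ cong (λ t → t ℚ.* W ℚ.* W′) r≡κr′ ⟩
    κ ℚ.* r′ ℚ.* W ℚ.* W′     ≡⟨ regroup κ r′ W W′ ⟩
    κ ℚ.* (r′ ℚ.* W′) ℚ.* W   ≡⟨ cong (λ t → κ ℚ.* t ℚ.* W) r′W′≡n′ ⟩
    κ ℚ.* n′ ℚ.* W            ∎
    where
    open +-*-Solver
    regroup : ∀ κ r′ W W′ → κ ℚ.* r′ ℚ.* W ℚ.* W′ ≡ κ ℚ.* (r′ ℚ.* W′) ℚ.* W
    regroup = solve 4 (λ κ r′ W W′ → κ :* r′ :* W :* W′ := κ :* (r′ :* W′) :* W) refl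

  cf₃-multiple-cleared : ∀ k a b c x y z → .{{ℕ.NonZero c}} → .{{ℕ.NonZero z}} →
                         cf a (b ∷ c ∷ []) ≡ ofℕ k ℚ.* cf x (y ∷ z ∷ []) →
                         numer a b c ℕ.* denom y z ≡ k ℕ.* numer x y z ℕ.* denom b c
  cf₃-multiple-cleared k a b c x y z r≡kr′ = ofℕ-injective (begin
    ofℕ (numer a b c ℕ.* denom y z)                 ≡⟨ ofℕ-* (numer a b c) (denom y z) ⟩
    ofℕ (numer a b c) ℚ.* ofℕ (denom y z)           ≡⟨ cross-multiply (ofℕ k) (cf₃-cleared a b c) (cf₃-cleared x y z) r≡kr′ ⟩
    ofℕ k ℚ.* ofℕ (numer x y z) ℚ.* ofℕ (denom b c) ≡⟨ cong (ℚ._* ofℕ (denom b c)) (sym (ofℕ-* k (numer x y z))) ⟩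
    ofℕ (k ℕ.* numer x y z) ℚ.* ofℕ (denom b c)     ≡⟨ sym (ofℕ-* (k ℕ.* numer x y z) (denom b c)) ⟩
    ofℕ (k ℕ.* numer x y z ℕ.* denom b c)           ∎)

open Clearing using (cf₃-multiple-cleared)

module Sizes where
  open import Data.Nat using (_+_; _*_; suc; zero; s≤s; z≤n; >-nonZero)
  open import Data.Nat.Properties
  open import Data.Nat.Divisibility using (_∣_; divides; ∣m+n∣m⇒∣n; ∣n⇒∣m*n; ∣1⇒≡1)
  open import Data.Nat.Coprimality using (Coprime; coprime-divisor)
  open import Data.Nat.Tactic.RingSolver using (solve-∀)
  import Data.Rational as ℚ
  open ≤-Reasoning

  -- A common divisor of numer a b c = c + a D and D = 1 + b c divides c, hence b c, hence 1.
  numer-denom-coprime : ∀ a b c → Coprime (numer a b c) (denom b c)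
  numer-denom-coprime a b c {d} (d∣N , d∣D) = ∣1⇒≡1 d∣1
    where
    d∣c : d ∣ c
    d∣c = ∣m+n∣m⇒∣n (subst (d ∣_) (+-comm c (a * denom b c)) d∣N) (∣n⇒∣m*n a d∣D)
    d∣1 : d ∣ 1
    d∣1 = ∣m+n∣m⇒∣n (subst (d ∣_) (+-comm 1 (b * c)) d∣D) (∣n⇒∣m*n b d∣c)

  -- Cleared equation N D′ = k N′ D: as N′ is coprime to D′, N′ divides N.
  numer-divides : ∀ k a b c x y z → numer a b c * denom y z ≡ k * numer x y z * denom b c →
                  numer x y z ∣ numer a b c
  numer-divides k a b c x y z cleared =
    coprime-divisor (numer-denom-coprime x y z) (divides (k * denom b c) (begin-equality
      denom y z * numer a b c          ≡⟨ *-comm (denom y z) (numer a b c) ⟩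
      numer a b c * denom y z          ≡⟨ cleared ⟩
      k * numer x y z * denom b c      ≡⟨ regroup k (numer x y z) (denom b c) ⟩
      k * denom b c * numer x y z      ∎))
    where
    regroup : ∀ k n d → k * n * d ≡ k * d * n
    regroup = solve-∀

  ∣-below-double : ∀ {m n} → m ∣ n → 0 < n → n < 2 * m → n ≡ m
  ∣-below-double {m} (divides zero n≡0) 0<n _ = ⊥-elim (<-irrefl (sym n≡0) 0<n)
  ∣-below-double {m} (divides 1 n≡m) _ _ = trans n≡m (*-identityˡ m)
  ∣-below-double {m} {n} (divides (suc (suc q)) n≡q*m) _ n<2m =
    ⊥-elim (<-irrefl refl (<-≤-trans n<2m (begin
      2 * m              ≤⟨ *-monoˡ-≤ m {2} {suc (suc q)} (s≤s (s≤s z≤n)) ⟩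
      suc (suc q) * m    ≡⟨ sym n≡q*m ⟩
      n                  ∎)))

  numer-split : ∀ a b c → numer a b c ≡ a * b * c + (a + c)
  numer-split a b c = expand a b c
    where
    expand : ∀ a b c → c + a * (1 + b * c) ≡ a * b * c + (a + c)
    expand = solve-∀

  outer-sum-bound : ∀ {a b c} → 1 ≤ a → 1 ≤ b → 1 ≤ c → a + c ≤ a * b * c + 1
  outer-sum-bound {suc i} {suc j} {suc l} _ _ _ =
    ≤-trans (m≤m+n (suc i + suc l) (i * l + j * (suc i * suc l))) (≤-reflexive (expand i j l))
    where
    expand : ∀ i j l → suc i + suc l + (i * l + j * (suc i * suc l)) ≡ suc i * suc j * suc l + 1
    expand = solve-∀

  numer-below-double : ∀ {a b c x y z} → 1 ≤ a → 1 ≤ b → 1 ≤ c → 1 ≤ z →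
                       x * y * z ≡ a * b * c → numer a b c < 2 * numer x y z
  numer-below-double {a} {b} {c} {x} {y} {z} 1≤a 1≤b 1≤c 1≤z xyz≡abc = begin-strict
    numer a b c              ≡⟨ numer-split a b c ⟩
    P + (a + c)              ≤⟨ +-monoʳ-≤ P (outer-sum-bound 1≤a 1≤b 1≤c) ⟩
    P + (P + 1)              <⟨ doubled P (x + z) (≤-trans 1≤z (m≤n+m z x)) ⟩
    2 * (P + (x + z))        ≡⟨ cong (2 *_) (sym (trans (numer-split x y z) (cong (_+ (x + z)) xyz≡abc))) ⟩
    2 * numer x y z          ∎
    where
    P = a * b * c
    doubled : ∀ P v → 1 ≤ v → P + (P + 1) < 2 * (P + v)
    doubled P (suc w) _ = ≤-trans (m≤m+n (suc (P + (P + 1))) (w + w)) (≤-reflexive (expand P w))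
      where
      expand : ∀ P w → suc (P + (P + 1)) + (w + w) ≡ 2 * (P + suc w)
      expand = solve-∀

  outer-sum-preserved : ∀ k {a b c x y z} → 1 ≤ a → 1 ≤ b → 1 ≤ c → 1 ≤ z → x * y * z ≡ a * b * c →
                        cf a (b ∷ c ∷ []) ≡ ofℕ k ℚ.* cf x (y ∷ z ∷ []) → a + c ≡ x + z
  outer-sum-preserved k {a} {b} {c} {x} {y} {z} 1≤a 1≤b 1≤c 1≤z xyz≡abc r≡kr′ =
    +-cancelˡ-≡ (a * b * c) (a + c) (x + z) (begin-equality
      a * b * c + (a + c)  ≡⟨ sym (numer-split a b c) ⟩
      numer a b c          ≡⟨ numers-equal ⟩
      numer x y z          ≡⟨ numer-split x y z ⟩
      x * y * z + (x + z)  ≡⟨ cong (_+ (x + z)) xyz≡abc ⟩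
      a * b * c + (x + z)  ∎)
    where
    cleared = cf₃-multiple-cleared k a b c x y z {{>-nonZero 1≤c}} {{>-nonZero 1≤z}} r≡kr′
    numers-equal : numer a b c ≡ numer x y z
    numers-equal = ∣-below-double (numer-divides k a b c x y z cleared)
                                  (≤-trans 1≤c (m≤m+n c (a * denom b c)))
                                  (numer-below-double {x = x} {y = y} 1≤a 1≤b 1≤c 1≤z xyz≡abc)

  not-self-multiple : ∀ {k} a b c → 2 ≤ k → 1 ≤ c → ¬ (cf a (b ∷ c ∷ []) ≡ ofℕ k ℚ.* cf a (b ∷ c ∷ []))
  not-self-multiple {k} a b (suc c) 2≤k _ r≡kr = <-irrefl (sym k≡1) 2≤k
    where
    N = numer a b (suc c)
    D = denom b (suc c)
    k≡1 : k ≡ 1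
    k≡1 = *-cancelʳ-≡ k 1 (N * D) {{m*n≢0 N D}} (begin-equality
      k * (N * D)  ≡⟨ sym (*-assoc k N D) ⟩
      k * N * D    ≡⟨ sym (cf₃-multiple-cleared k a b (suc c) a b (suc c) r≡kr) ⟩
      N * D        ≡⟨ sym (*-identityˡ (N * D)) ⟩
      1 * (N * D)  ∎)

module Rearrangements where
  open import Data.Nat using (_+_; _*_)
  open import Data.Nat.Properties using (+-cancelˡ-≡; +-cancelʳ-≡; +-comm)
  open import Data.Nat.Tactic.RingSolver using (solve-∀)

  data Rearrangement {A : Set} (a b c : A) : A → A → A → Set where
    abc : Rearrangement a b c a b c
    acb : Rearrangement a b c a c b
    bac : Rearrangement a b c b a c
    bca : Rearrangement a b c b c a
    cab : Rearrangement a b c c a b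
    cba : Rearrangement a b c c b a

  rearrangement-product : ∀ {a b c x y z} → Rearrangement a b c x y z → x * y * z ≡ a * b * c
  rearrangement-product abc = refl
  rearrangement-product {a} {b} {c} acb = reorder a b c
    where
    reorder : ∀ a b c → a * c * b ≡ a * b * c
    reorder = solve-∀
  rearrangement-product {a} {b} {c} bac = reorder a b c
    where
    reorder : ∀ a b c → b * a * c ≡ a * b * c
    reorder = solve-∀
  rearrangement-product {a} {b} {c} bca = reorder a b c
    where
    reorder : ∀ a b c → b * c * a ≡ a * b * c
    reorder = solve-∀
  rearrangement-product {a} {b} {c} cab = reorder a b c
    where
    reorder : ∀ a b c → c * a * b ≡ a * b * c
    reorder = solve-∀
  rearrangement-product {a} {b} {c} cba = reorder a b c
    where
    reorder : ∀ a b c → c * b * a ≡ a * b * c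
    reorder = solve-∀

  identity-or-reverse : ∀ {a b c x y z} → Rearrangement a b c x y z → a + c ≡ x + z →
                        (x ≡ a × y ≡ b × z ≡ c) ⊎ (x ≡ c × y ≡ b × z ≡ a)
  identity-or-reverse abc _ = inj₁ (refl , refl , refl)
  identity-or-reverse {a} {b} {c} acb a+c≡a+b = inj₁ (refl , c≡b , sym c≡b)
    where
    c≡b = +-cancelˡ-≡ a c b a+c≡a+b
  identity-or-reverse {a} {b} {c} bac a+c≡b+c = inj₁ (sym a≡b , a≡b , refl)
    where
    a≡b = +-cancelʳ-≡ c a b a+c≡b+c
  identity-or-reverse {a} {b} {c} bca a+c≡b+a = inj₂ (sym c≡b , c≡b , refl)
    where
    c≡b = +-cancelˡ-≡ a c b (trans a+c≡b+a (+-comm b a))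
  identity-or-reverse {a} {b} {c} cab a+c≡c+b = inj₂ (refl , a≡b , sym a≡b)
    where
    a≡b = +-cancelˡ-≡ c a b (trans (+-comm c a) a+c≡c+b)
  identity-or-reverse cba _ = inj₂ (refl , refl , refl)

  distinct-indices : ∀ {A : Set} (f : Fin 3 → A) i j l → i ≢ j → i ≢ l → j ≢ l →
                     Rearrangement (f 0F) (f 1F) (f 2F) (f i) (f j) (f l)
  distinct-indices f 0F 1F 2F _ _ _ = abc
  distinct-indices f 0F 2F 1F _ _ _ = acb
  distinct-indices f 1F 0F 2F _ _ _ = bac
  distinct-indices f 1F 2F 0F _ _ _ = bca
  distinct-indices f 2F 0F 1F _ _ _ = cab
  distinct-indices f 2F 1F 0F _ _ _ = cba
  distinct-indices f 0F 0F _  i≢j _ _ = ⊥-elim (i≢j refl)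
  distinct-indices f 1F 1F _  i≢j _ _ = ⊥-elim (i≢j refl)
  distinct-indices f 2F 2F _  i≢j _ _ = ⊥-elim (i≢j refl)
  distinct-indices f 0F _  0F _ i≢l _ = ⊥-elim (i≢l refl)
  distinct-indices f 1F _  1F _ i≢l _ = ⊥-elim (i≢l refl)
  distinct-indices f 2F _  2F _ i≢l _ = ⊥-elim (i≢l refl)
  distinct-indices f _  0F 0F _ _ j≢l = ⊥-elim (j≢l refl)
  distinct-indices f _  1F 1F _ _ j≢l = ⊥-elim (j≢l refl)
  distinct-indices f _  2F 2F _ _ j≢l = ⊥-elim (j≢l refl)

  permute-≢ : ∀ {n} (σ : Permutation′ n) {i j} → i ≢ j → σ ⟨$⟩ʳ i ≢ σ ⟨$⟩ʳ j
  permute-≢ σ {i} {j} i≢j σi≡σj = i≢j (begin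
    i                      ≡⟨ sym (inverseˡ σ) ⟩
    σ ⟨$⟩ˡ (σ ⟨$⟩ʳ i)      ≡⟨ cong (σ ⟨$⟩ˡ_) σi≡σj ⟩
    σ ⟨$⟩ˡ (σ ⟨$⟩ʳ j)      ≡⟨ inverseˡ σ ⟩
    j                      ∎)
    where open ≡-Reasoning

  permutation-rearranges : ∀ {A : Set} (f : Fin 3 → A) (σ : Permutation′ 3) →
                           Rearrangement (f 0F) (f 1F) (f 2F) (f (σ ⟨$⟩ʳ 0F)) (f (σ ⟨$⟩ʳ 1F)) (f (σ ⟨$⟩ʳ 2F))
  permutation-rearranges f σ =
    distinct-indices f (σ ⟨$⟩ʳ 0F) (σ ⟨$⟩ʳ 1F) (σ ⟨$⟩ʳ 2F)
      (permute-≢ σ (λ ())) (permute-≢ σ (λ ())) (permute-≢ σ (λ ()))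

open Sizes using (outer-sum-preserved; not-self-multiple)
open Rearrangements using (Rearrangement; rearrangement-product; identity-or-reverse; permutation-rearranges)
open import Data.Rational using (_*_)

three-digit-permutiple : ∀ k {a b c x y z} → 1 < k → 1 ≤ a → 1 ≤ b → 1 ≤ c → 1 ≤ z →
                         Rearrangement a b c x y z →
                         cf a (b ∷ c ∷ []) ≡ ofℕ k * cf x (y ∷ z ∷ []) → x ≡ c × y ≡ b × z ≡ a
three-digit-permutiple k {a} {b} {c} 1<k 1≤a 1≤b 1≤c 1≤z ρ r≡kr′
  with identity-or-reverse ρ (outer-sum-preserved k 1≤a 1≤b 1≤c 1≤z (rearrangement-product ρ) r≡kr′)
... | inj₁ (refl , refl , refl) = ⊥-elim (not-self-multiple a b c 1<k 1≤c r≡kr′)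
... | inj₂ reversed = reversed

mainTheorem4 : (k : ℕ) → 1 < k → (a : Fin 3 → ℕ) → (∀ i → 1 ≤ a i) → 2 ≤ a (Fin.suc (Fin.suc Fin.zero))
    → (σ : Permutation′ 3) → 2 ≤ a (σ ⟨$⟩ʳ Fin.suc (Fin.suc Fin.zero))
    → cf (a Fin.zero) (a (Fin.suc Fin.zero) ∷ a (Fin.suc (Fin.suc Fin.zero)) ∷ [])
      ≡ ofℕ k * cf (a (σ ⟨$⟩ʳ Fin.zero)) (a (σ ⟨$⟩ʳ Fin.suc Fin.zero) ∷ a (σ ⟨$⟩ʳ Fin.suc (Fin.suc Fin.zero)) ∷ [])
    → (K (a Fin.zero ∷ a (Fin.suc Fin.zero) ∷ a (Fin.suc (Fin.suc Fin.zero)) ∷ [])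
        ≡ K (a (σ ⟨$⟩ʳ Fin.zero) ∷ a (σ ⟨$⟩ʳ Fin.suc Fin.zero) ∷ a (σ ⟨$⟩ʳ Fin.suc (Fin.suc Fin.zero)) ∷ []))
      × (2 ≤ a Fin.zero)
      × (cf (a Fin.zero) (a (Fin.suc Fin.zero) ∷ a (Fin.suc (Fin.suc Fin.zero)) ∷ [])
          ≡ ofℕ k * cf (a (Fin.suc (Fin.suc Fin.zero))) (a (Fin.suc Fin.zero) ∷ a Fin.zero ∷ []))
mainTheorem4 k 1<k a positive _ σ 2≤aσ₂ r≡kr′ =
  reverse-multiple
    (three-digit-permutiple k 1<k (positive 0F) (positive 1F) (positive 2F) (positive (σ ⟨$⟩ʳ 2F))
                            (permutation-rearranges a σ) r≡kr′)
    2≤aσ₂ r≡kr′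
  where
  A = a 0F
  B = a 1F
  C = a 2F
  reverse-multiple : ∀ {x y z} → x ≡ C × y ≡ B × z ≡ A → 2 ≤ z →
                     cf A (B ∷ C ∷ []) ≡ ofℕ k * cf x (y ∷ z ∷ []) →
                     (K (A ∷ B ∷ C ∷ []) ≡ K (x ∷ y ∷ z ∷ [])) × (2 ≤ A) ×
                     (cf A (B ∷ C ∷ []) ≡ ofℕ k * cf C (B ∷ A ∷ []))
  reverse-multiple (refl , refl , refl) 2≤A r≡kr̃ = K-reverse A B C , 2≤A , r≡kr̃
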